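{- For the complete graphs $K_n$: $\eta(K_1)=0$, $\eta(K_2)=\infty$, $\eta(K_n)=3$ for $n\in\{3,4,5\}$, and $\eta(K_n)=2$ for all $n\ge 6$.
   Context: For a vertex $v$ of a finite simple graph $G$, its link is $L(v)=G[N(v)]$. An edge-labeling is a map $l:E(G)\to\mathbb{Z}^+$; the labeled link $L_l(v)$ is $L(v)$ with edges carrying their labels; labeled graphs are isomorphic if there is a label-preserving isomorphism. A labeling is link-irregular if $L_l(u)\not\cong L_l(v)$ for all distinct $u,v\in V(G)$. The link-irregular labeling number $\eta(G)$ is the minimum number of distinct labels used by a link-irregular labeling of $G$ (so a graph with no edges that is vacuously link-irregular has $\eta=0$), and $\eta(G)=\infty$ if no link-irregular labeling exists. -}

module Defs where

open import Data.Nat using (ℕ; _≤_)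
open import Data.Fin using (Fin; _≟_)
open import Data.Bool using (Bool; true; false; not)
open import Data.Maybe using (Maybe; just; nothing)
open import Data.Product using (Σ; ∃; ∃-syntax; _×_; proj₁)
open import Relation.Nullary using (¬_; does)
open import Relation.Binary.PropositionalEquality using (_≡_; _≢_)
open import Function.Bundles using (_↔_; Inverse)
open import Function.Definitions using (Injective)

record Graph (n : ℕ) : Set where
  field
    Adj    : Fin n → Fin n → Bool
    adj-sym    : ∀ i j → Adj i j ≡ Adj j i
    adj-irrefl : ∀ i → Adj i i ≡ false

open Graph public

Edge : ∀ {n} → Graph n → Fin n → Fin n → Set
Edge G i j = Adj G i j ≡ true

K : (n : ℕ) → Graph n
K n = record
  { Adj    = λ i j → not (does (i ≟ j))
  ; adj-sym    = symK
  ; adj-irrefl = irrK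
  }
  where
  open import Relation.Binary.PropositionalEquality using (refl; sym)
  open import Relation.Nullary using (yes; no)
  symK : ∀ (i j : Fin n) → not (does (i ≟ j)) ≡ not (does (j ≟ i))
  symK i j with i ≟ j | j ≟ i
  ... | yes _ | yes _ = refl
  ... | no _  | no _  = refl
  ... | yes p | no q  = Data.Empty.⊥-elim (q (sym p))
    where import Data.Empty
  ... | no p  | yes q = Data.Empty.⊥-elim (p (sym q))
    where import Data.Empty
  irrK : ∀ (i : Fin n) → not (does (i ≟ i)) ≡ false
  irrK i with i ≟ i
  ... | yes _ = refl
  ... | no p  = Data.Empty.⊥-elim (p refl)
    where import Data.Empty

-- An edge-labeling l : E(G) → ℤ⁺, represented as a function on ordered
-- pairs that is symmetric and positive on edges (values on non-edges
-- are irrelevant and never inspected).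
record Labeling {n : ℕ} (G : Graph n) : Set where
  field
    lab     : Fin n → Fin n → ℕ
    lab-sym : ∀ i j → Edge G i j → lab i j ≡ lab j i
    lab-pos : ∀ i j → Edge G i j → 1 ≤ lab i j

open Labeling public

Nbhd : ∀ {n} → Graph n → Fin n → Set
Nbhd {n} G v = Σ (Fin n) (λ x → Edge G v x)

-- L_l(u) ≅ L_l(v): a bijection N(u) ↔ N(v) preserving adjacency and
-- non-adjacency (induced subgraph) and preserving labels on edges.
LinkIso : ∀ {n} {G : Graph n} → Labeling G → Fin n → Fin n → Set
LinkIso {G = G} L u v =
  Σ (Nbhd G u ↔ Nbhd G v) λ φ →
    ∀ (x y : Nbhd G u) →
      let f = Inverse.to φ in
      (Adj G (proj₁ x) (proj₁ y) ≡ Adj G (proj₁ (f x)) (proj₁ (f y)))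
      × (Edge G (proj₁ x) (proj₁ y) →
           lab L (proj₁ x) (proj₁ y) ≡ lab L (proj₁ (f x)) (proj₁ (f y)))

LinkIrregular : ∀ {n} {G : Graph n} → Labeling G → Set
LinkIrregular {n} L = ∀ (u v : Fin n) → u ≢ v → ¬ LinkIso L u v

UsesExactly : ∀ {n} {G : Graph n} → Labeling G → ℕ → Set
UsesExactly {n} {G} L k =
  Σ (Fin k → ℕ) λ f →
    Injective _≡_ _≡_ f
    × (∀ i j → Edge G i j → ∃[ a ] lab L i j ≡ f a)
    × (∀ a → ∃[ i ] ∃[ j ] (Edge G i j × lab L i j ≡ f a))

-- η(G) = e, with e : Maybe ℕ and nothing standing for ∞.
η-is : ∀ {n} → Graph n → Maybe ℕ → Set
η-is G (just k) =
  (∃[ L ] (LinkIrregular {G = G} L × UsesExactly L k))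
  × (∀ (L : Labeling G) (j : ℕ) → LinkIrregular L → UsesExactly L j → k ≤ j)
η-is G nothing = ∀ (L : Labeling G) → ¬ LinkIrregular L

{-# OPTIONS --safe #-}
-- In K n a link isomorphism between u and v is the same thing as a permutation π of the
-- vertices with π u = v that preserves the labels of the edges avoiding u.  Lower bounds:
-- with one label, swapping the vertices 0 and 1 identifies their links; for n = 3, 4, 5, an
-- exhaustive computation shows that every 2-colouring of the edges of K n is preserved, off
-- some vertex u, by a product of two transpositions moving u.
-- Upper bounds: for n ≥ 6, on the vertices 0, …, n − 1 let H be the graph with a ~ b iff
-- a + b > n, together with 0 ~ 1 and 0 ~ b for 2b > n, and give its edges label 2 and all
-- other edges label 1.  The link of u contains |E(H)| − deg u edges of H, so the H-degree is
-- a link invariant, and vertex a ≥ 2 has H-degree a − 1.  The remaining vertices are told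
-- apart by an isolated vertex of H − u (u = 0 or u = n − 1), a dominating vertex of H − 1,
-- and a vertex of H − 0 missing exactly one neighbour.  For n = 3, 4, 5 explicit labelings
-- with three labels are separated by computed link invariants of the same kind.
module Submission where

open import Defs
open import Axiom.UniquenessOfIdentityProofs using (module Decidable⇒UIP)
open import Data.Bool using (Bool; true; false; not; if_then_else_; _∧_; T)
import Data.Bool.Properties as Bool
open import Data.Fin using (Fin; zero; suc; _≟_; toℕ; fromℕ; fromℕ<; punchIn)
open import Data.Fin.Permutation
  using (Permutation′; _⟨$⟩ʳ_; _⟨$⟩ˡ_; inverseˡ; inverseʳ; permutation; flip; transpose; _∘ₚ_)
open import Data.Fin.Properties
  using (punchInᵢ≢i; suc-injective; toℕ-injective; toℕ-fromℕ<; toℕ<n; toℕ-fromℕ; toℕ≤pred[n];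
         all?; any?)
open import Data.List using (List; []; _∷_; map; _++_)
import Data.List.Properties as List
open import Data.Maybe using (just; nothing)
open import Data.Nat using (ℕ; zero; suc; _+_; _*_; _∸_; _≤_; _<_; z≤n; s≤s; pred; _<?_)
open import Data.Nat.Properties
  using (+-0-commutativeMonoid; +-cancelˡ-≡; *-cancelˡ-≡; +-comm; +-identityʳ; <⇒≯; <⇒≱; <⇒≤;
         ≤-trans; ≤∧≢⇒<; m≤m+n; +-monoˡ-≤; +-monoʳ-<; ∸-monoˡ-<; m+n∸m≡n; m+[n∸m]≡n; m∸[m∸n]≡n;
         pred[m∸n]≡m∸[1+n])
  renaming (_≟_ to _≟ℕ_)
import Data.Nat.Properties as ℕ
open import Algebra.Properties.CommutativeMonoid.Sum +-0-commutativeMonoid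
  using (sum; sum-remove; sum-permute; sum-cong-≗; ∑-distrib-+)
open import Data.Nat.Solver using (module +-*-Solver)
open import Data.Product using (∃₂; ∃-syntax; _×_; _,_; proj₁; proj₂)
open import Data.Sum using (_⊎_; inj₁; inj₂)
open import Data.Unit using (⊤; tt)
open import Data.Vec using (Vec; []; _∷_; lookup; tabulate)
open import Data.Vec.Properties using (lookup∘tabulate)
open import Function.Base using (_∘_)
open import Function.Bundles using (Inverse; Equivalence; _↔_; _⇔_; mk↔ₛ′; mk⇔)
open import Relation.Binary.Definitions using (DecidableEquality)
open import Relation.Binary.PropositionalEquality
open import Relation.Nullary using (¬_; Dec; yes; no; does; isYes; contradiction)
open import Relation.Nullary.Decidable
  using (does-⇔; dec-true; dec-false; _×-dec_; _⊎-dec_; _→-dec_; ¬?; toWitness; True)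

module _ {n : ℕ} where

  ≢⇒Edge : {x y : Fin n} → x ≢ y → Edge (K n) x y
  ≢⇒Edge {x} {y} x≢y with x ≟ y
  ... | yes x≡y = contradiction x≡y x≢y
  ... | no _    = refl

  Edge⇒≢ : {x y : Fin n} → Edge (K n) x y → x ≢ y
  Edge⇒≢ {x} e refl with x ≟ x
  Edge⇒≢ () refl | yes _
  ... | no x≢x = x≢x refl

  Nbhd-≡ : {u : Fin n} {x y : Nbhd (K n) u} → proj₁ x ≡ proj₁ y → x ≡ y
  Nbhd-≡ {x = x , e} {y = .x , e′} refl = cong (x ,_) (Decidable⇒UIP.≡-irrelevant Bool._≟_ e e′)

  module _ (π : Permutation′ n) where

    permute-injective : {x y : Fin n} → π ⟨$⟩ʳ x ≡ π ⟨$⟩ʳ y → x ≡ y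
    permute-injective e = trans (sym (inverseˡ π)) (trans (cong (π ⟨$⟩ˡ_) e) (inverseˡ π))

    permute-≢ : {x y : Fin n} → x ≢ y → π ⟨$⟩ʳ x ≢ π ⟨$⟩ʳ y
    permute-≢ x≢y = x≢y ∘ permute-injective

    unpermute-≢ : {x y : Fin n} → y ≢ π ⟨$⟩ʳ x → π ⟨$⟩ˡ y ≢ x
    unpermute-≢ y≢πx e = y≢πx (trans (sym (inverseʳ π)) (cong (π ⟨$⟩ʳ_) e))

    Adj-permute : (x y : Fin n) → Adj (K n) (π ⟨$⟩ʳ x) (π ⟨$⟩ʳ y) ≡ Adj (K n) x y
    Adj-permute x y =
      cong not (does-⇔ (mk⇔ permute-injective (cong (π ⟨$⟩ʳ_))) (π ⟨$⟩ʳ x ≟ π ⟨$⟩ʳ y) (x ≟ y))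

    Nbhd-permute : (u : Fin n) → Nbhd (K n) u ↔ Nbhd (K n) (π ⟨$⟩ʳ u)
    Nbhd-permute u =
      mk↔ₛ′ to from (λ _ → Nbhd-≡ {π ⟨$⟩ʳ u} (inverseʳ π)) (λ _ → Nbhd-≡ {u} (inverseˡ π))
      where
      to : Nbhd (K n) u → Nbhd (K n) (π ⟨$⟩ʳ u)
      to (x , e) = π ⟨$⟩ʳ x , trans (Adj-permute u x) e
      from : Nbhd (K n) (π ⟨$⟩ʳ u) → Nbhd (K n) u
      from (y , e) = π ⟨$⟩ˡ y , ≢⇒Edge (unpermute-≢ (≢-sym (Edge⇒≢ e)) ∘ sym)

  extend : (u v : Fin n) → (Nbhd (K n) u → Nbhd (K n) v) → Fin n → Fin n
  extend u v f x with x ≟ u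
  ... | yes _   = v
  ... | no x≢u = proj₁ (f (x , ≢⇒Edge (≢-sym x≢u)))

  module _ (u v : Fin n) (f : Nbhd (K n) u → Nbhd (K n) v) where

    extend-base : extend u v f u ≡ v
    extend-base with u ≟ u
    ... | yes _   = refl
    ... | no u≢u = contradiction refl u≢u

    extend-Nbhd : (x : Nbhd (K n) u) → extend u v f (proj₁ x) ≡ proj₁ (f x)
    extend-Nbhd (x , e) with x ≟ u
    ... | yes x≡u = contradiction (sym x≡u) (Edge⇒≢ e)
    ... | no _    = cong (proj₁ ∘ f) (Nbhd-≡ {u} refl)

  extend-inverse : (u v : Fin n) (f : Nbhd (K n) u → Nbhd (K n) v) (g : Nbhd (K n) v → Nbhd (K n) u) →
                   (∀ x → g (f x) ≡ x) → ∀ x → extend v u g (extend u v f x) ≡ x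
  extend-inverse u v f g gf x with x ≟ u
  ... | yes refl = extend-base v u g
  ... | no x≢u   = trans (extend-Nbhd v u g (f x̂)) (cong proj₁ (gf x̂))
    where
    x̂ : Nbhd (K n) u
    x̂ = x , ≢⇒Edge (≢-sym x≢u)

  Nbhd↔⇒Permutation : (u v : Fin n) → Nbhd (K n) u ↔ Nbhd (K n) v → Permutation′ n
  Nbhd↔⇒Permutation u v φ = permutation (extend u v to) (extend v u from)
    (extend-inverse v u from to strictlyInverseˡ) (extend-inverse u v to from strictlyInverseʳ)
    where open Inverse φ

module _ {A : Set} {n : ℕ} where

  PreservesOff : (Fin n → Fin n → A) → Permutation′ n → Fin n → Set
  PreservesOff M π u = ∀ x y → x ≢ u → y ≢ u → x ≢ y → M (π ⟨$⟩ʳ x) (π ⟨$⟩ʳ y) ≡ M x y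

  module _ (M : Fin n → Fin n → A) (π : Permutation′ n) {u : Fin n} (pres : PreservesOff M π u) where

    PreservesOff-flip : PreservesOff M (flip π) (π ⟨$⟩ʳ u)
    PreservesOff-flip x y x≢πu y≢πu x≢y =
      trans (sym (pres _ _ (unpermute-≢ π x≢πu) (unpermute-≢ π y≢πu)
                           (x≢y ∘ permute-injective (flip π))))
            (cong₂ M (inverseʳ π) (inverseʳ π))

    PreservesOff-⟨$⟩ˡ : ∀ {x y} → x ≢ u → y ≢ π ⟨$⟩ʳ u → y ≢ π ⟨$⟩ʳ x →
                        M (π ⟨$⟩ʳ x) y ≡ M x (π ⟨$⟩ˡ y)
    PreservesOff-⟨$⟩ˡ x≢u y≢πu y≢πx =
      trans (cong (M _) (sym (inverseʳ π)))
            (pres _ _ x≢u (unpermute-≢ π y≢πu) (unpermute-≢ π y≢πx ∘ sym))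

module _ {n : ℕ} (L : Labeling (K n)) where

  LinkPermutation : Fin n → Fin n → Set
  LinkPermutation u v = ∃[ π ] π ⟨$⟩ʳ u ≡ v × PreservesOff (lab L) π u

  LinkPermutation-sym : ∀ {u v} → LinkPermutation u v → LinkPermutation v u
  LinkPermutation-sym {u} (π , refl , pres) = flip π , inverseˡ π {u} , PreservesOff-flip (lab L) π pres

  LinkPermutation⇒LinkIso : ∀ {u v} → LinkPermutation u v → LinkIso L u v
  LinkPermutation⇒LinkIso {u} (π , refl , pres) = Nbhd-permute π u , λ (x , ux) (y , uy) →
    sym (Adj-permute π x y) ,
    λ xy → sym (pres x y (≢-sym (Edge⇒≢ ux)) (≢-sym (Edge⇒≢ uy)) (Edge⇒≢ xy))

  LinkIso⇒LinkPermutation : ∀ {u v} → LinkIso L u v → LinkPermutation u v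
  LinkIso⇒LinkPermutation {u} {v} (φ , φ-iso) = π , extend-base u v to , pres
    where
    open Inverse φ
    π : Permutation′ n
    π = Nbhd↔⇒Permutation u v φ
    pres : PreservesOff (lab L) π u
    pres x y x≢u y≢u x≢y = begin
      lab L (extend u v to x) (extend u v to y)
        ≡⟨ cong₂ (lab L) (extend-Nbhd u v to x̂) (extend-Nbhd u v to ŷ) ⟩
      lab L (proj₁ (to x̂)) (proj₁ (to ŷ))
        ≡⟨ proj₂ (φ-iso x̂ ŷ) (≢⇒Edge x≢y) ⟨
      lab L x y ∎
      where
      open ≡-Reasoning
      x̂ ŷ : Nbhd (K n) u
      x̂ = x , ≢⇒Edge (≢-sym x≢u)
      ŷ = y , ≢⇒Edge (≢-sym y≢u)

  LabelInLink : Fin n → ℕ → Set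
  LabelInLink u a = ∃₂ λ x y → x ≢ u × y ≢ u × x ≢ y × lab L x y ≡ a

  StarInLink : Fin n → ℕ → Set
  StarInLink u a = ∃[ x ] x ≢ u × ∀ y → y ≢ u → y ≢ x → lab L x y ≡ a

  NearStarInLink : Fin n → ℕ → ℕ → Set
  NearStarInLink u a b = ∃₂ λ x y → x ≢ u × y ≢ u × y ≢ x × lab L x y ≡ a ×
                                     ∀ z → z ≢ u → z ≢ x → z ≢ y → lab L x z ≡ b

  module _ {u v : Fin n} where

    LabelInLink-transport : ∀ {a} → LinkPermutation u v → LabelInLink u a → LabelInLink v a
    LabelInLink-transport (π , refl , pres) (x , y , x≢u , y≢u , x≢y , xy≡a) =
      π ⟨$⟩ʳ x , π ⟨$⟩ʳ y , permute-≢ π x≢u , permute-≢ π y≢u , permute-≢ π x≢y ,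
      trans (pres x y x≢u y≢u x≢y) xy≡a

    StarInLink-transport : ∀ {a} → LinkPermutation u v → StarInLink u a → StarInLink v a
    StarInLink-transport (π , refl , pres) (x , x≢u , star) =
      π ⟨$⟩ʳ x , permute-≢ π x≢u , λ y y≢πu y≢πx →
        trans (PreservesOff-⟨$⟩ˡ (lab L) π pres x≢u y≢πu y≢πx)
              (star _ (unpermute-≢ π y≢πu) (unpermute-≢ π y≢πx))

    NearStarInLink-transport : ∀ {a b} → LinkPermutation u v → NearStarInLink u a b → NearStarInLink v a b
    NearStarInLink-transport (π , refl , pres) (x , y , x≢u , y≢u , y≢x , xy≡a , near) =
      π ⟨$⟩ʳ x , π ⟨$⟩ʳ y , permute-≢ π x≢u , permute-≢ π y≢u , permute-≢ π y≢x ,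
      trans (pres x y x≢u y≢u (≢-sym y≢x)) xy≡a , λ z z≢πu z≢πx z≢πy →
        trans (PreservesOff-⟨$⟩ˡ (lab L) π pres x≢u z≢πu z≢πx)
              (near _ (unpermute-≢ π z≢πu) (unpermute-≢ π z≢πx) (unpermute-≢ π z≢πy))

  labelInLink? : ∀ u a → Dec (LabelInLink u a)
  labelInLink? u a = any? λ x → any? λ y →
    ¬? (x ≟ u) ×-dec (¬? (y ≟ u) ×-dec (¬? (x ≟ y) ×-dec (lab L x y ≟ℕ a)))

  starInLink? : ∀ u a → Dec (StarInLink u a)
  starInLink? u a = any? λ x → ¬? (x ≟ u) ×-dec
    all? λ y → ¬? (y ≟ u) →-dec (¬? (y ≟ x) →-dec (lab L x y ≟ℕ a))

  linkProfile : List ℕ → Fin n → List Bool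
  linkProfile labels u = map (does ∘ labelInLink? u) labels ++ map (does ∘ starInLink? u) labels

  linkProfile-invariant : ∀ labels {u v} → LinkPermutation u v → linkProfile labels u ≡ linkProfile labels v
  linkProfile-invariant labels {u} {v} φ = cong₂ _++_
    (List.map-cong (λ a → does-⇔ (mk⇔ (LabelInLink-transport φ) (LabelInLink-transport φ⁻¹))
                                 (labelInLink? u a) (labelInLink? v a)) labels)
    (List.map-cong (λ a → does-⇔ (mk⇔ (StarInLink-transport φ) (StarInLink-transport φ⁻¹))
                                 (starInLink? u a) (starInLink? v a)) labels)
    where
    φ⁻¹ : LinkPermutation v u
    φ⁻¹ = LinkPermutation-sym φ

  linkProfile-injective? : ∀ labels → Dec (∀ u v → linkProfile labels u ≡ linkProfile labels v → u ≡ v)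
  linkProfile-injective? labels = all? λ u → all? λ v →
    List.≡-dec Bool._≟_ (linkProfile labels u) (linkProfile labels v) →-dec (u ≟ v)

  linkProfile-injective⇒LinkIrregular : ∀ labels →
    (∀ u v → linkProfile labels u ≡ linkProfile labels v → u ≡ v) → LinkIrregular L
  linkProfile-injective⇒LinkIrregular labels injective u v u≢v iso =
    u≢v (injective u v (linkProfile-invariant labels (LinkIso⇒LinkPermutation iso)))

module _ {k : ℕ} where

  offSum : (Fin (suc k) → Fin (suc k) → ℕ) → Fin (suc k) → ℕ
  offSum W u = sum λ i → sum λ j → W (punchIn u i) (punchIn u j)

  sum²-split : (W : Fin (suc k) → Fin (suc k) → ℕ) (u : Fin (suc k)) →
               (∀ x y → W x y ≡ W y x) → W u u ≡ 0 →
               sum (λ x → sum (W x)) ≡ offSum W u + 2 * sum (W u)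
  sum²-split W u W-sym Wuu≡0 = begin
    sum (λ x → sum (W x))
      ≡⟨ sum-remove {i = u} (λ x → sum (W x)) ⟩
    sum (W u) + sum (λ i → sum (W (punchIn u i)))
      ≡⟨ cong (sum (W u) +_) (sum-cong-≗ λ i → sum-remove {i = u} (W (punchIn u i))) ⟩
    sum (W u) + sum (λ i → W (punchIn u i) u + sum (λ j → W (punchIn u i) (punchIn u j)))
      ≡⟨ cong (sum (W u) +_) (∑-distrib-+ (λ i → W (punchIn u i) u) _) ⟩
    sum (W u) + (sum (λ i → W (punchIn u i) u) + offSum W u)
      ≡⟨ cong (λ r → sum (W u) + (r + offSum W u)) column≡row ⟩
    sum (W u) + (sum (W u) + offSum W u)
      ≡⟨ solve 2 (λ r o → r :+ (r :+ o) := o :+ con 2 :* r) refl (sum (W u)) (offSum W u) ⟩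
    offSum W u + 2 * sum (W u) ∎
    where
    open ≡-Reasoning
    open +-*-Solver
    column≡row : sum (λ i → W (punchIn u i) u) ≡ sum (W u)
    column≡row = trans (sum-cong-≗ λ i → W-sym (punchIn u i) u)
                       (sym (trans (sum-remove {i = u} (W u)) (cong (_+ sum (λ i → W u (punchIn u i))) Wuu≡0)))

  row-sum-invariant : (W : Fin (suc k) → Fin (suc k) → ℕ) (π : Permutation′ (suc k)) (u : Fin (suc k)) →
                      (∀ x y → W x y ≡ W y x) → (∀ x → W x x ≡ 0) →
                      (∀ x y → x ≢ u → y ≢ u → W (π ⟨$⟩ʳ x) (π ⟨$⟩ʳ y) ≡ W x y) →
                      sum (W (π ⟨$⟩ʳ u)) ≡ sum (W u)
  row-sum-invariant W π u W-sym W-diag pres = *-cancelˡ-≡ _ _ 2 (+-cancelˡ-≡ (offSum W u) _ _ (begin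
    offSum W u + 2 * sum (W (π ⟨$⟩ʳ u))
      ≡⟨ cong₂ (λ o r → o + 2 * r) (sym offSum-permute) (sum-permute (W (π ⟨$⟩ʳ u)) π) ⟩
    offSum Wπ u + 2 * sum (Wπ u)
      ≡⟨ sum²-split Wπ u (λ x y → W-sym _ _) (W-diag _) ⟨
    sum (λ x → sum (Wπ x))
      ≡⟨ sum-cong-≗ (λ x → sum-permute (W (π ⟨$⟩ʳ x)) π) ⟨
    sum (λ x → sum (W (π ⟨$⟩ʳ x)))
      ≡⟨ sum-permute (λ x → sum (W x)) π ⟨
    sum (λ x → sum (W x))
      ≡⟨ sum²-split W u W-sym (W-diag u) ⟩
    offSum W u + 2 * sum (W u) ∎))
    where
    open ≡-Reasoning
    Wπ : Fin (suc k) → Fin (suc k) → ℕ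
    Wπ x y = W (π ⟨$⟩ʳ x) (π ⟨$⟩ʳ y)
    offSum-permute : offSum Wπ u ≡ offSum W u
    offSum-permute = sum-cong-≗ λ i → sum-cong-≗ λ j → pres _ _ (punchInᵢ≢i u i) (punchInᵢ≢i u j)

module _ {k : ℕ} (w : ℕ → ℕ) (L : Labeling (K (suc k))) where

  degree : Fin (suc k) → ℕ
  degree u = sum λ i → w (lab L u (punchIn u i))

  private
    weight : Fin (suc k) → Fin (suc k) → ℕ
    weight x y = if does (x ≟ y) then 0 else w (lab L x y)

    weight-≢ : ∀ {x y} → x ≢ y → weight x y ≡ w (lab L x y)
    weight-≢ {x} {y} x≢y with x ≟ y
    ... | yes x≡y = contradiction x≡y x≢y
    ... | no _    = refl

    weight-diag : ∀ x → weight x x ≡ 0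
    weight-diag x with x ≟ x
    ... | yes _   = refl
    ... | no x≢x = contradiction refl x≢x

    weight-sym : ∀ x y → weight x y ≡ weight y x
    weight-sym x y with x ≟ y
    ... | yes refl = sym (weight-diag x)
    ... | no x≢y   = trans (cong w (lab-sym L x y (≢⇒Edge x≢y))) (sym (weight-≢ (≢-sym x≢y)))

    sum-weight : ∀ u → sum (weight u) ≡ degree u
    sum-weight u = begin
      sum (weight u)
        ≡⟨ sum-remove {i = u} (weight u) ⟩
      weight u u + sum (λ i → weight u (punchIn u i))
        ≡⟨ cong₂ _+_ (weight-diag u) (sum-cong-≗ λ i → weight-≢ (punchInᵢ≢i u i ∘ sym)) ⟩
      degree u ∎
      where open ≡-Reasoning

  degree-invariant : ∀ {u v} → LinkPermutation L u v → degree u ≡ degree v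
  degree-invariant {u} (π , refl , pres) = begin
    degree u                 ≡⟨ sum-weight u ⟨
    sum (weight u)           ≡⟨ row-sum-invariant weight π u weight-sym weight-diag weight-pres ⟨
    sum (weight (π ⟨$⟩ʳ u))  ≡⟨ sum-weight (π ⟨$⟩ʳ u) ⟩
    degree (π ⟨$⟩ʳ u)        ∎
    where
    open ≡-Reasoning
    weight-pres : ∀ x y → x ≢ u → y ≢ u → weight (π ⟨$⟩ʳ x) (π ⟨$⟩ʳ y) ≡ weight x y
    weight-pres x y x≢u y≢u with x ≟ y
    ... | yes refl = weight-diag (π ⟨$⟩ʳ x)
    ... | no x≢y   = trans (weight-≢ (permute-≢ π x≢y)) (cong w (pres x y x≢u y≢u x≢y))

module _ {k : ℕ} (L : Labeling (K (2 + k))) where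

  constant⇒¬LinkIrregular : ∀ {c} → (∀ x y → x ≢ y → lab L x y ≡ c) → ¬ LinkIrregular L
  constant⇒¬LinkIrregular constant irregular =
    irregular zero (suc zero) (λ ()) (LinkPermutation⇒LinkIso L {zero} (π , refl , λ x y _ _ x≢y →
      trans (constant _ _ (permute-≢ π x≢y)) (sym (constant x y x≢y))))
    where
    π : Permutation′ (2 + k)
    π = transpose zero (suc zero)

  LinkIrregular-usesAtLeast2 : ∀ {j} → LinkIrregular L → UsesExactly L j → 2 ≤ j
  LinkIrregular-usesAtLeast2 {zero} _ (_ , _ , cov , _) with cov zero (suc zero) refl
  ... | () , _
  LinkIrregular-usesAtLeast2 {suc zero} irregular (f , _ , cov , _) =
    contradiction irregular (constant⇒¬LinkIrregular (λ x y x≢y → onlyLabel (cov x y (≢⇒Edge x≢y))))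
    where
    onlyLabel : ∀ {ℓ} → ∃[ a ] ℓ ≡ f a → ℓ ≡ f zero
    onlyLabel (zero , ℓ≡f0) = ℓ≡f0
  LinkIrregular-usesAtLeast2 {suc (suc j)} _ _ = s≤s (s≤s z≤n)

K2-¬LinkIrregular : (L : Labeling (K 2)) → ¬ LinkIrregular L
K2-¬LinkIrregular L = constant⇒¬LinkIrregular L edge
  where
  edge : ∀ x y → x ≢ y → lab L x y ≡ lab L zero (suc zero)
  edge zero       zero       0≢0 = contradiction refl 0≢0
  edge zero       (suc zero) _   = refl
  edge (suc zero) zero       _   = lab-sym L (suc zero) zero refl
  edge (suc zero) (suc zero) 1≢1 = contradiction refl 1≢1

-- A symmetric matrix on Fin n, stored row by row strictly above the diagonal.
Triangle : Set → ℕ → Set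
Triangle A zero    = ⊤
Triangle A (suc n) = Vec A n × Triangle A n

module _ {A : Set} (diagonal : A) where

  entry : ∀ {n} → Triangle A n → Fin n → Fin n → A
  entry (r , t) zero    zero    = diagonal
  entry (r , t) zero    (suc j) = lookup r j
  entry (r , t) (suc i) zero    = lookup r i
  entry (r , t) (suc i) (suc j) = entry t i j

  entry-sym : ∀ {n} (t : Triangle A n) x y → entry t x y ≡ entry t y x
  entry-sym (r , t) zero    zero    = refl
  entry-sym (r , t) zero    (suc j) = refl
  entry-sym (r , t) (suc i) zero    = refl
  entry-sym (r , t) (suc i) (suc j) = entry-sym t i j

  triangle : ∀ {n} → (Fin n → Fin n → A) → Triangle A n
  triangle {zero}  M = tt
  triangle {suc n} M = tabulate (M zero ∘ suc) , triangle (λ i j → M (suc i) (suc j))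

  entry-triangle : ∀ {n} (M : Fin n → Fin n → A) → (∀ x y → x ≢ y → M x y ≡ M y x) →
                   ∀ x y → x ≢ y → entry (triangle M) x y ≡ M x y
  entry-triangle M M-sym zero    zero    0≢0 = contradiction refl 0≢0
  entry-triangle M M-sym zero    (suc j) _   = lookup∘tabulate (M zero ∘ suc) j
  entry-triangle M M-sym (suc i) zero    _   =
    trans (lookup∘tabulate (M zero ∘ suc) i) (M-sym zero (suc i) (λ ()))
  entry-triangle M M-sym (suc i) (suc j) i≢j =
    entry-triangle (λ i j → M (suc i) (suc j)) (λ x y x≢y → M-sym (suc x) (suc y) (x≢y ∘ suc-injective))
                   i j (i≢j ∘ cong suc)

allVec : ∀ n → (Vec Bool n → Bool) → Bool
allVec zero    p = p []
allVec (suc n) p = allVec n (p ∘ (true ∷_)) ∧ allVec n (p ∘ (false ∷_))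

allVec-sound : ∀ n (p : Vec Bool n → Bool) → T (allVec n p) → ∀ v → T (p v)
allVec-sound zero    p all [] = all
allVec-sound (suc n) p all (b ∷ v)
  with Equivalence.to (Bool.T-∧ {allVec n (p ∘ (true ∷_))} {allVec n (p ∘ (false ∷_))}) all
... | all-true , all-false with b
...   | true  = allVec-sound n (p ∘ (true ∷_)) all-true v
...   | false = allVec-sound n (p ∘ (false ∷_)) all-false v

allTriangle : ∀ n → (Triangle Bool n → Bool) → Bool
allTriangle zero    p = p tt
allTriangle (suc n) p = allVec n λ r → allTriangle n λ t → p (r , t)

allTriangle-sound : ∀ n (p : Triangle Bool n → Bool) → T (allTriangle n p) → ∀ t → T (p t)
allTriangle-sound zero    p all tt      = all
allTriangle-sound (suc n) p all (r , t) =
  allTriangle-sound n (λ t → p (r , t)) (allVec-sound n _ all r) t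

module _ {A : Set} {n : ℕ} where

  IsTwinning : (Fin n → Fin n → A) → Permutation′ n → Fin n → Set
  IsTwinning M π u = π ⟨$⟩ʳ u ≢ u × PreservesOff M π u

  HasTwinLinks : (Fin n → Fin n → A) → Set
  HasTwinLinks M = ∃₂ λ π u → IsTwinning M π u

  isTwinning? : DecidableEquality A → ∀ M π u → Dec (IsTwinning M π u)
  isTwinning? _≟ᴬ_ M π u = ¬? (π ⟨$⟩ʳ u ≟ u) ×-dec
    all? λ x → all? λ y → ¬? (x ≟ u) →-dec (¬? (y ≟ u) →-dec (¬? (x ≟ y) →-dec
      (M (π ⟨$⟩ʳ x) (π ⟨$⟩ʳ y) ≟ᴬ M x y)))

doubleTransposition : ∀ {n} → Fin n → Fin n → Fin n → Fin n → Permutation′ n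
doubleTransposition a b c d = transpose a b ∘ₚ transpose c d

twinByDoubleTransposition? : ∀ {n} (M : Fin n → Fin n → Bool) →
  Dec (∃₂ λ c d → ∃₂ λ a b → IsTwinning M (doubleTransposition a b c d) a)
twinByDoubleTransposition? M =
  any? λ c → any? λ d → any? λ a → any? λ b → isTwinning? Bool._≟_ M (doubleTransposition a b c d) a

checkedColourings-haveTwinLinks : ∀ n →
  allTriangle n (λ t → isYes (twinByDoubleTransposition? (entry false t))) ≡ true →
  ∀ t → HasTwinLinks (entry false t)
checkedColourings-haveTwinLinks n checked t
  with toWitness {a? = twinByDoubleTransposition? (entry false t)}
                 (allTriangle-sound n _ (Equivalence.from Bool.T-≡ checked) t)
... | c , d , a , b , twinning = doubleTransposition a b c d , a , twinning

-- Each `refl` runs the search over all 2-colourings; products of two transpositions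
-- happen to suffice up to n = 5.
smallColourings-haveTwinLinks : ∀ n → 3 ≤ n → n ≤ 5 → (t : Triangle Bool n) → HasTwinLinks (entry false t)
smallColourings-haveTwinLinks 1 (s≤s ()) _
smallColourings-haveTwinLinks 2 (s≤s (s≤s ())) _
smallColourings-haveTwinLinks 3 _ _ = checkedColourings-haveTwinLinks 3 refl
smallColourings-haveTwinLinks 4 _ _ = checkedColourings-haveTwinLinks 4 refl
smallColourings-haveTwinLinks 5 _ _ = checkedColourings-haveTwinLinks 5 refl
smallColourings-haveTwinLinks (suc (suc (suc (suc (suc (suc _)))))) _ (s≤s (s≤s (s≤s (s≤s (s≤s ())))))

module _ {A : Set} (_≟ᴬ_ : DecidableEquality A) {a b : A} where

  twoValued-≡ : ∀ {p q} → p ≡ a ⊎ p ≡ b → q ≡ a ⊎ q ≡ b →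
                does (p ≟ᴬ a) ≡ does (q ≟ᴬ a) → p ≡ q
  twoValued-≡ {p} {q} p∈ q∈ same with p ≟ᴬ a | q ≟ᴬ a
  twoValued-≡ _  _  _  | yes p≡a | yes q≡a = trans p≡a (sym q≡a)
  twoValued-≡ p∈ q∈ _  | no p≢a  | no q≢a  = trans (other p∈ p≢a) (sym (other q∈ q≢a))
    where
    other : ∀ {r} → r ≡ a ⊎ r ≡ b → r ≢ a → r ≡ b
    other (inj₁ r≡a) r≢a = contradiction r≡a r≢a
    other (inj₂ r≡b) _   = r≡b
  twoValued-≡ _  _  () | yes _ | no _
  twoValued-≡ _  _  () | no _  | yes _

module _ {A B : Set} {n : ℕ} where

  Determines : (Fin n → Fin n → A) → (Fin n → Fin n → B) → Set
  Determines M N = ∀ {x y x′ y′} → x ≢ y → x′ ≢ y′ → M x y ≡ M x′ y′ → N x y ≡ N x′ y′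

  HasTwinLinks-determines : {M : Fin n → Fin n → A} {N : Fin n → Fin n → B} →
                            Determines M N → HasTwinLinks M → HasTwinLinks N
  HasTwinLinks-determines determines (π , u , moved , pres) =
    π , u , moved , λ x y x≢u y≢u x≢y → determines (permute-≢ π x≢y) x≢y (pres x y x≢u y≢u x≢y)

HasTwinLinks⇒¬LinkIrregular : ∀ {n} (L : Labeling (K n)) → HasTwinLinks (lab L) → ¬ LinkIrregular L
HasTwinLinks⇒¬LinkIrregular L (π , u , moved , pres) irregular =
  irregular u (π ⟨$⟩ʳ u) (≢-sym moved) (LinkPermutation⇒LinkIso L {u} (π , refl , pres))

twoLabels-¬LinkIrregular : ∀ n → 3 ≤ n → n ≤ 5 → (L : Labeling (K n)) →
                           UsesExactly L 2 → ¬ LinkIrregular L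
twoLabels-¬LinkIrregular n 3≤n n≤5 L (f , _ , cov , _) =
  HasTwinLinks⇒¬LinkIrregular L (HasTwinLinks-determines colour-determines-lab
    (HasTwinLinks-determines entry-determines-colour
      (smallColourings-haveTwinLinks n 3≤n n≤5 (triangle false colour))))
  where
  colour : Fin n → Fin n → Bool
  colour x y = does (lab L x y ≟ℕ f zero)

  colour-sym : ∀ x y → x ≢ y → colour x y ≡ colour y x
  colour-sym x y x≢y = cong (λ ℓ → does (ℓ ≟ℕ f zero)) (lab-sym L x y (≢⇒Edge x≢y))

  entry-determines-colour : Determines (entry false (triangle false colour)) colour
  entry-determines-colour {x} {y} {x′} {y′} x≢y x′≢y′ same =
    trans (sym (entry-triangle false colour colour-sym x y x≢y))
          (trans same (entry-triangle false colour colour-sym x′ y′ x′≢y′))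

  twoLabels : ∀ {x y} → x ≢ y → lab L x y ≡ f zero ⊎ lab L x y ≡ f (suc zero)
  twoLabels x≢y with cov _ _ (≢⇒Edge x≢y)
  ... | zero     , ℓ≡f0 = inj₁ ℓ≡f0
  ... | suc zero , ℓ≡f1 = inj₂ ℓ≡f1

  colour-determines-lab : Determines colour (lab L)
  colour-determines-lab x≢y x′≢y′ = twoValued-≡ _≟ℕ_ (twoLabels x≢y) (twoLabels x′≢y′)

LinkIrregular-usesAtLeast3 : ∀ n → 3 ≤ n → n ≤ 5 → (L : Labeling (K n)) →
                             ∀ {j} → LinkIrregular L → UsesExactly L j → 3 ≤ j
LinkIrregular-usesAtLeast3 1 (s≤s ()) _ _ _ _
LinkIrregular-usesAtLeast3 n@(suc (suc _)) 3≤n n≤5 L irregular uses =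
  ≤∧≢⇒< (LinkIrregular-usesAtLeast2 L irregular uses)
        λ { refl → twoLabels-¬LinkIrregular n 3≤n n≤5 L uses irregular }

module _ {n : ℕ} (c : Fin n → Fin n → ℕ) where

  HasRange : ℕ → Set
  HasRange k = (∀ x y → x ≢ y → c x y < k) ×
               (∀ (a : Fin k) → ∃₂ λ x y → x ≢ y × c x y ≡ toℕ a)

  hasRange? : ∀ k → Dec (HasRange k)
  hasRange? k =
    (all? λ x → all? λ y → ¬? (x ≟ y) →-dec (c x y <? k)) ×-dec
    (all? λ a → any? λ x → any? λ y → ¬? (x ≟ y) ×-dec (c x y ≟ℕ toℕ a))

  shiftedLabeling : (∀ x y → c x y ≡ c y x) → Labeling (K n)
  shiftedLabeling c-sym = record
    { lab     = λ x y → suc (c x y)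
    ; lab-sym = λ x y _ → cong suc (c-sym x y)
    ; lab-pos = λ _ _ _ → s≤s z≤n
    }

  shiftedLabeling-usesExactly : ∀ {k} (c-sym : ∀ x y → c x y ≡ c y x) → HasRange k →
                                UsesExactly (shiftedLabeling c-sym) k
  shiftedLabeling-usesExactly c-sym (bounded , attained) =
    suc ∘ toℕ , toℕ-injective ∘ ℕ.suc-injective ,
    (λ x y e → fromℕ< (bounded x y (Edge⇒≢ e)) , cong suc (sym (toℕ-fromℕ< _))) ,
    λ a → let x , y , x≢y , cxy≡a = attained a in x , y , ≢⇒Edge x≢y , cong suc cxy≡a

tableLabeling : ∀ {n} → Triangle ℕ n → Labeling (K n)
tableLabeling t = shiftedLabeling (entry 0 t) (entry-sym 0 t)

K3-table : Triangle ℕ 3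
K3-table = (0 ∷ 1 ∷ []) , (2 ∷ []) , [] , tt

K4-table : Triangle ℕ 4
K4-table = (0 ∷ 1 ∷ 2 ∷ []) , (0 ∷ 0 ∷ []) , (0 ∷ []) , [] , tt

K5-table : Triangle ℕ 5
K5-table = (0 ∷ 0 ∷ 0 ∷ 1 ∷ []) , (0 ∷ 1 ∷ 0 ∷ []) , (1 ∷ 2 ∷ []) , (1 ∷ []) , [] , tt

threeLabels : List ℕ
threeLabels = 1 ∷ 2 ∷ 3 ∷ []

η≡3-byTable : ∀ {n} (t : Triangle ℕ n) → 3 ≤ n → n ≤ 5 →
              True (hasRange? (entry 0 t) 3) → True (linkProfile-injective? (tableLabeling t) threeLabels) →
              η-is (K n) (just 3)
η≡3-byTable {n} t 3≤n n≤5 range injective =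
  (tableLabeling t ,
   linkProfile-injective⇒LinkIrregular (tableLabeling t) threeLabels (toWitness injective) ,
   shiftedLabeling-usesExactly (entry 0 t) (entry-sym 0 t) (toWitness range)) ,
  λ L _ → LinkIrregular-usesAtLeast3 n 3≤n n≤5 L

indicator : {A : Set} → Dec A → ℕ
indicator d = if does d then 1 else 0

indicator-cong : {A B : Set} → A ⇔ B → (a? : Dec A) (b? : Dec B) → indicator a? ≡ indicator b?
indicator-cong A⇔B a? b? = cong (λ b → if b then 1 else 0) (does-⇔ A⇔B a? b?)

count-< : ∀ M t → sum {M} (λ y → indicator (t <? toℕ y)) ≡ M ∸ suc t
count-< zero    t       = refl
count-< (suc M) zero    = count-all M
  where
  count-all : ∀ M → sum {M} (λ y → indicator (0 <? suc (toℕ y))) ≡ M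
  count-all zero    = refl
  count-all (suc M) = cong suc (count-all M)
count-< (suc M) (suc t) = count-< M t

N<a+b⇔N∸a<b : ∀ {N a b} → a ≤ N → N < a + b ⇔ N ∸ a < b
N<a+b⇔N∸a<b {N} {a} {b} a≤N = mk⇔
  (λ N<a+b → subst (N ∸ a <_) (m+n∸m≡n a b) (∸-monoˡ-< N<a+b a≤N))
  (λ N∸a<b → subst (_< a + b) (m+[n∸m]≡n a≤N) (+-monoʳ-< a N∸a<b))

module HeavyGraph (m : ℕ) where

  N : ℕ
  N = 6 + m

  ZeroNeighbour : ℕ → Set
  ZeroNeighbour b = b ≡ 1 ⊎ N < b + b

  Heavy : ℕ → ℕ → Set
  Heavy a b = a ≢ b × (N < a + b ⊎ (a ≡ 0 × ZeroNeighbour b) ⊎ (b ≡ 0 × ZeroNeighbour a))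

  heavy? : ∀ a b → Dec (Heavy a b)
  heavy? a b = ¬? (a ≟ℕ b) ×-dec (N <? a + b ⊎-dec ((a ≟ℕ 0 ×-dec zeroNeighbour? b) ⊎-dec
                                                    (b ≟ℕ 0 ×-dec zeroNeighbour? a)))
    where
    zeroNeighbour? : ∀ b → Dec (ZeroNeighbour b)
    zeroNeighbour? b = b ≟ℕ 1 ⊎-dec N <? b + b

  Heavy-sym : ∀ {a b} → Heavy a b → Heavy b a
  Heavy-sym {a} {b} (a≢b , inj₁ N<a+b)   = ≢-sym a≢b , inj₁ (subst (N <_) (+-comm a b) N<a+b)
  Heavy-sym         (a≢b , inj₂ (inj₁ p)) = ≢-sym a≢b , inj₂ (inj₂ p)
  Heavy-sym         (a≢b , inj₂ (inj₂ p)) = ≢-sym a≢b , inj₂ (inj₁ p)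

  ¬Heavy-sum≤N : ∀ {a b} → 1 ≤ a → 1 ≤ b → a + b ≤ N → ¬ Heavy a b
  ¬Heavy-sum≤N _  _  a+b≤N (_ , inj₁ N<a+b)             = <⇒≱ N<a+b a+b≤N
  ¬Heavy-sum≤N () _  _     (_ , inj₂ (inj₁ (refl , _)))
  ¬Heavy-sum≤N _  () _     (_ , inj₂ (inj₂ (refl , _)))

  Heavy-sum>N : ∀ {a b} → a ≢ b → N < a + b → Heavy a b
  Heavy-sum>N a≢b N<a+b = a≢b , inj₁ N<a+b

  Heavy-0 : ∀ {b} → b ≢ 0 → ZeroNeighbour b → Heavy 0 b
  Heavy-0 b≢0 b~0 = ≢-sym b≢0 , inj₂ (inj₁ (refl , b~0))

  ¬Heavy-0 : ∀ {b} → 2 ≤ b → b + b ≤ N → ¬ Heavy 0 b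
  ¬Heavy-0 _   b+b≤N (_ , inj₁ N<b)                     = <⇒≱ N<b (≤-trans (m≤m+n _ _) b+b≤N)
  ¬Heavy-0 2≤b _     (_ , inj₂ (inj₁ (_ , inj₁ refl)))  = contradiction 2≤b λ { (s≤s ()) }
  ¬Heavy-0 _   b+b≤N (_ , inj₂ (inj₁ (_ , inj₂ N<b+b))) = <⇒≱ N<b+b b+b≤N
  ¬Heavy-0 ()  _     (_ , inj₂ (inj₂ (refl , _)))

  heaviness : Fin N → Fin N → ℕ
  heaviness x y = indicator (heavy? (toℕ x) (toℕ y))

  heaviness-sym : ∀ x y → heaviness x y ≡ heaviness y x
  heaviness-sym x y =
    indicator-cong (mk⇔ Heavy-sym Heavy-sym) (heavy? (toℕ x) (toℕ y)) (heavy? (toℕ y) (toℕ x))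

  heaviness-diag : ∀ x → heaviness x x ≡ 0
  heaviness-diag x =
    cong (λ b → if b then 1 else 0) (dec-false (heavy? (toℕ x) (toℕ x)) λ (x≢x , _) → x≢x refl)

  module _ {a : ℕ} (2≤a : 2 ≤ a) (a<N : a < N) where

    private
      â : Fin N
      â = fromℕ< a<N

      a≢0 : a ≢ 0
      a≢0 a≡0 = contradiction (subst (2 ≤_) a≡0 2≤a) λ ()

      a≢1 : a ≢ 1
      a≢1 a≡1 = contradiction (subst (2 ≤_) a≡1 2≤a) λ { (s≤s ()) }

      N≮a+0 : ¬ N < a + 0
      N≮a+0 N<a+0 = <⇒≯ a<N (subst (N <_) (+-identityʳ a) N<a+0)

    -- Swapping 0 and a turns the H-neighbourhood of a into {y | N < a + y}.
    Heavy⇔transpose : ∀ y → Heavy a (toℕ y) ⇔ N < a + toℕ (transpose zero â ⟨$⟩ʳ y)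
    Heavy⇔transpose y with y ≟ zero
    ... | yes refl =
      subst (λ b → Heavy a 0 ⇔ N < a + b) (sym (toℕ-fromℕ< a<N))
            (mk⇔ to (λ N<a+a → a≢0 , inj₂ (inj₂ (refl , inj₂ N<a+a))))
      where
      to : Heavy a 0 → N < a + a
      to (_ , inj₁ N<a+0)                   = contradiction N<a+0 N≮a+0
      to (_ , inj₂ (inj₁ (a≡0 , _)))        = contradiction a≡0 a≢0
      to (_ , inj₂ (inj₂ (_ , inj₁ a≡1)))   = contradiction a≡1 a≢1
      to (_ , inj₂ (inj₂ (_ , inj₂ N<a+a))) = N<a+a
    ... | no y≢0 with y ≟ â
    ...   | yes refl =
      mk⇔ (λ (a≢â , _) → contradiction (sym (toℕ-fromℕ< a<N)) a≢â)
          (λ N<a+0 → contradiction N<a+0 N≮a+0)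
    ...   | no y≢â = mk⇔ to (λ N<a+y → a≢y , inj₁ N<a+y)
      where
      a≢y : a ≢ toℕ y
      a≢y a≡y = y≢â (toℕ-injective (trans (sym a≡y) (sym (toℕ-fromℕ< a<N))))
      to : Heavy a (toℕ y) → N < a + toℕ y
      to (_ , inj₁ N<a+y)            = N<a+y
      to (_ , inj₂ (inj₁ (a≡0 , _))) = contradiction a≡0 a≢0
      to (_ , inj₂ (inj₂ (y≡0 , _))) = contradiction (toℕ-injective y≡0) y≢0

    heavyCount : sum {N} (λ y → indicator (heavy? a (toℕ y))) ≡ pred a
    heavyCount = begin
      sum {N} (λ y → indicator (heavy? a (toℕ y)))
        ≡⟨ sum-cong-≗ {N} (λ y → indicator-cong (Heavy⇔transpose y) (heavy? a (toℕ y)) (N <? _)) ⟩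
      sum {N} (λ y → indicator (N <? a + toℕ (transpose zero â ⟨$⟩ʳ y)))
        ≡⟨ sum-permute (λ y → indicator (N <? a + toℕ y)) (transpose zero â) ⟨
      sum {N} (λ y → indicator (N <? a + toℕ y))
        ≡⟨ sum-cong-≗ {N} (λ y → indicator-cong (N<a+b⇔N∸a<b (<⇒≤ a<N))
                                                (N <? a + toℕ y) (N ∸ a <? toℕ y)) ⟩
      sum {N} (λ y → indicator (N ∸ a <? toℕ y))
        ≡⟨ count-< N (N ∸ a) ⟩
      N ∸ suc (N ∸ a)
        ≡⟨ pred[m∸n]≡m∸[1+n] N (N ∸ a) ⟨
      pred (N ∸ (N ∸ a))
        ≡⟨ cong pred (m∸[m∸n]≡n (<⇒≤ a<N)) ⟩
      pred a ∎
      where open ≡-Reasoning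

  L : Labeling (K N)
  L = shiftedLabeling heaviness heaviness-sym

  -- pred turns the labels 1 and 2 back into heaviness.
  degree-L : ∀ x → 2 ≤ toℕ x → degree pred L x ≡ pred (toℕ x)
  degree-L x 2≤x = begin
    degree pred L x                  ≡⟨ cong (_+ degree pred L x) (heaviness-diag x) ⟨
    heaviness x x + degree pred L x  ≡⟨ sum-remove {i = x} (heaviness x) ⟨
    sum (heaviness x)                ≡⟨ heavyCount 2≤x (toℕ<n x) ⟩
    pred (toℕ x)                     ∎
    where open ≡-Reasoning

  degree-separates : ∀ {u v} → LinkPermutation L (suc (suc u)) (suc (suc v)) → u ≡ v
  degree-separates {u} {v} φ = toℕ-injective (ℕ.suc-injective (begin
    suc (toℕ u)                  ≡⟨ degree-L (suc (suc u)) (s≤s (s≤s z≤n)) ⟨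
    degree pred L (suc (suc u))  ≡⟨ degree-invariant pred L φ ⟩
    degree pred L (suc (suc v))  ≡⟨ degree-L (suc (suc v)) (s≤s (s≤s z≤n)) ⟩
    suc (toℕ v)                  ∎))
    where open ≡-Reasoning

  HeavyEdge : Fin N → Fin N → Set
  HeavyEdge x y = Heavy (toℕ x) (toℕ y)

  HeavyEdge⇒lab≡2 : ∀ {x y} → HeavyEdge x y → lab L x y ≡ 2
  HeavyEdge⇒lab≡2 {x} {y} h =
    cong (λ b → suc (if b then 1 else 0)) (dec-true (heavy? (toℕ x) (toℕ y)) h)

  ¬HeavyEdge⇒lab≡1 : ∀ {x y} → ¬ HeavyEdge x y → lab L x y ≡ 1
  ¬HeavyEdge⇒lab≡1 {x} {y} ¬h =
    cong (λ b → suc (if b then 1 else 0)) (dec-false (heavy? (toℕ x) (toℕ y)) ¬h)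

  last : Fin N
  last = fromℕ (5 + m)

  private
    toℕ-last : toℕ last ≡ 5 + m
    toℕ-last = toℕ-fromℕ (5 + m)

  HeavyEdge-last : ∀ {x} → 2 ≤ toℕ x → x ≢ last → HeavyEdge x last
  HeavyEdge-last {x} 2≤x x≢last = subst (Heavy (toℕ x)) (sym toℕ-last)
    (Heavy-sum>N (x≢last ∘ toℕ-injective ∘ λ x≡ → trans x≡ (sym toℕ-last))
                 (+-monoˡ-≤ (5 + m) 2≤x))

  HeavyEdge-0-last : HeavyEdge zero last
  HeavyEdge-0-last = subst (Heavy 0) (sym toℕ-last)
    (Heavy-0 (λ ()) (inj₂ (+-monoˡ-≤ (5 + m) (s≤s (s≤s (z≤n {3 + m}))))))

  HeavyEdge-0-1 : HeavyEdge zero (suc zero)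
  HeavyEdge-0-1 = Heavy-0 (λ ()) (inj₁ refl)

  ¬HeavyEdge-1 : ∀ {x} → x ≢ zero → ¬ HeavyEdge (suc zero) x
  ¬HeavyEdge-1 {zero}  0≢0 = contradiction refl 0≢0
  ¬HeavyEdge-1 {suc x} _   = ¬Heavy-sum≤N (s≤s z≤n) (s≤s z≤n) (toℕ<n (suc x))

  ¬HeavyEdge-2 : ∀ {x} → x ≢ zero → x ≢ last → ¬ HeavyEdge (suc (suc zero)) x
  ¬HeavyEdge-2 {zero}  0≢0 _      = contradiction refl 0≢0
  ¬HeavyEdge-2 {suc x} _   x≢last = ¬Heavy-sum≤N (s≤s z≤n) (s≤s z≤n) (s≤s below-last)
    where
    below-last : toℕ (suc x) < 5 + m
    below-last =
      ≤∧≢⇒< (toℕ≤pred[n] (suc x)) (x≢last ∘ toℕ-injective ∘ λ x≡ → trans x≡ (sym toℕ-last))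

  ¬HeavyEdge-0-2 : ¬ HeavyEdge zero (suc (suc zero))
  ¬HeavyEdge-0-2 = ¬Heavy-0 (s≤s (s≤s z≤n)) (s≤s (s≤s (s≤s (s≤s z≤n))))

  ¬HeavyEdge-0-3 : ¬ HeavyEdge zero (suc (suc (suc zero)))
  ¬HeavyEdge-0-3 = ¬Heavy-0 (s≤s (s≤s z≤n)) (s≤s (s≤s (s≤s (s≤s (s≤s (s≤s z≤n))))))

  private
    1≢2 : 1 ≢ 2
    1≢2 ()

  isolatedIn-0 : StarInLink L zero 1
  isolatedIn-0 = suc zero , (λ ()) , λ y y≢0 _ → ¬HeavyEdge⇒lab≡1 (¬HeavyEdge-1 y≢0)

  ¬isolatedIn : ∀ {v} → v ≢ zero → v ≢ last → ¬ StarInLink L v 1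
  ¬isolatedIn {v} v≢0 v≢last (x , x≢v , isolated) with heavyNeighbour x x≢v
    where
    heavyNeighbour : ∀ x → x ≢ v → ∃[ y ] y ≢ v × y ≢ x × HeavyEdge x y
    heavyNeighbour zero _ with v ≟ suc zero
    ... | yes _  = last , ≢-sym v≢last , (λ ()) , HeavyEdge-0-last
    ... | no v≢1 = suc zero , ≢-sym v≢1 , (λ ()) , HeavyEdge-0-1
    heavyNeighbour (suc zero) _ = zero , ≢-sym v≢0 , (λ ()) , Heavy-sym HeavyEdge-0-1
    heavyNeighbour x@(suc (suc _)) _ with x ≟ last
    ... | yes x≡last =
      zero , ≢-sym v≢0 , (λ ()) , subst (λ x → HeavyEdge x zero) (sym x≡last) (Heavy-sym HeavyEdge-0-last)
    ... | no x≢last  = last , ≢-sym v≢last , ≢-sym x≢last , HeavyEdge-last (s≤s (s≤s z≤n)) x≢last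
  ... | y , y≢v , y≢x , heavy = 1≢2 (trans (sym (isolated y y≢v y≢x)) (HeavyEdge⇒lab≡2 heavy))

  dominatingIn-1 : StarInLink L (suc zero) 2
  dominatingIn-1 = last , (λ ()) , λ y y≢1 y≢last → HeavyEdge⇒lab≡2 (heavy y y≢1 y≢last)
    where
    heavy : ∀ y → y ≢ suc zero → y ≢ last → HeavyEdge last y
    heavy zero          _   _      = Heavy-sym HeavyEdge-0-last
    heavy (suc zero)    1≢1 _      = contradiction refl 1≢1
    heavy (suc (suc y)) _   y≢last = Heavy-sym (HeavyEdge-last (s≤s (s≤s z≤n)) y≢last)

  ¬dominatingIn : ∀ {v} → v ≢ zero → v ≢ suc zero → ¬ StarInLink L v 2
  ¬dominatingIn {v} v≢0 v≢1 (x , x≢v , dominating) with lightNeighbour x x≢v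
    where
    lightNeighbour : ∀ x → x ≢ v → ∃[ y ] y ≢ v × y ≢ x × ¬ HeavyEdge x y
    lightNeighbour zero _ with v ≟ suc (suc zero)
    ... | yes v≡2 =
      suc (suc (suc zero)) , (λ 3≡v → contradiction (trans 3≡v v≡2) λ ()) , (λ ()) , ¬HeavyEdge-0-3
    ... | no v≢2  = suc (suc zero) , ≢-sym v≢2 , (λ ()) , ¬HeavyEdge-0-2
    lightNeighbour (suc zero) _ with v ≟ suc (suc zero)
    ... | yes v≡2 =
      suc (suc (suc zero)) , (λ 3≡v → contradiction (trans 3≡v v≡2) λ ()) , (λ ()) , ¬HeavyEdge-1 (λ ())
    ... | no v≢2  = suc (suc zero) , ≢-sym v≢2 , (λ ()) , ¬HeavyEdge-1 (λ ())
    lightNeighbour (suc (suc _)) _ = suc zero , ≢-sym v≢1 , (λ ()) , ¬HeavyEdge-1 (λ ()) ∘ Heavy-sym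
  ... | y , y≢v , y≢x , light = 1≢2 (trans (sym (¬HeavyEdge⇒lab≡1 light)) (dominating y y≢v y≢x))

  nearlyDominatingIn-0 : NearStarInLink L zero 1 2
  nearlyDominatingIn-0 =
    last , suc zero , (λ ()) , (λ ()) , (λ ()) , ¬HeavyEdge⇒lab≡1 (¬HeavyEdge-1 {last} (λ ()) ∘ Heavy-sym) ,
    λ z z≢0 z≢last z≢1 → HeavyEdge⇒lab≡2 (heavy z z≢0 z≢1 z≢last)
    where
    heavy : ∀ z → z ≢ zero → z ≢ suc zero → z ≢ last → HeavyEdge last z
    heavy zero          0≢0 _   _      = contradiction refl 0≢0
    heavy (suc zero)    _   1≢1 _      = contradiction refl 1≢1
    heavy (suc (suc z)) _   _   z≢last = Heavy-sym (HeavyEdge-last (s≤s (s≤s z≤n)) z≢last)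

  ¬nearlyDominatingIn-last : ¬ NearStarInLink L last 1 2
  ¬nearlyDominatingIn-last (x , y , x≢last , _ , _ , _ , nearlyDominating) with twoLightNeighbours x x≢last
    where
    twoLightNeighbours : ∀ x → x ≢ last → ∃₂ λ z₁ z₂ → z₁ ≢ z₂ × z₁ ≢ last × z₂ ≢ last ×
                           z₁ ≢ x × z₂ ≢ x × ¬ HeavyEdge x z₁ × ¬ HeavyEdge x z₂
    twoLightNeighbours zero _ =
      suc (suc zero) , suc (suc (suc zero)) , (λ ()) , (λ ()) , (λ ()) , (λ ()) , (λ ()) ,
      ¬HeavyEdge-0-2 , ¬HeavyEdge-0-3
    twoLightNeighbours (suc zero) _ =
      suc (suc zero) , suc (suc (suc zero)) , (λ ()) , (λ ()) , (λ ()) , (λ ()) , (λ ()) ,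
      ¬HeavyEdge-1 (λ ()) , ¬HeavyEdge-1 (λ ())
    twoLightNeighbours (suc (suc zero)) _ =
      zero , suc zero , (λ ()) , (λ ()) , (λ ()) , (λ ()) , (λ ()) ,
      ¬HeavyEdge-0-2 ∘ Heavy-sym , ¬HeavyEdge-1 (λ ()) ∘ Heavy-sym
    twoLightNeighbours (suc (suc (suc x))) x≢last =
      suc zero , suc (suc zero) , (λ ()) , (λ ()) , (λ ()) , (λ ()) , (λ ()) ,
      ¬HeavyEdge-1 (λ ()) ∘ Heavy-sym , ¬HeavyEdge-2 (λ ()) x≢last ∘ Heavy-sym
  ... | z₁ , z₂ , z₁≢z₂ , z₁≢last , z₂≢last , z₁≢x , z₂≢x , light₁ , light₂ with z₁ ≟ y
  ...   | yes z₁≡y = 1≢2 (trans (sym (¬HeavyEdge⇒lab≡1 light₂))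
                                 (nearlyDominating z₂ z₂≢last z₂≢x (z₁≢z₂ ∘ trans z₁≡y ∘ sym)))
  ...   | no z₁≢y  = 1≢2 (trans (sym (¬HeavyEdge⇒lab≡1 light₁))
                                 (nearlyDominating z₁ z₁≢last z₁≢x z₁≢y))

  L-linkIrregular : LinkIrregular L
  L-linkIrregular u v u≢v iso = separated u v u≢v (LinkIso⇒LinkPermutation L iso)
    where
    separatedFrom-0 : ∀ v → zero ≢ v → ¬ LinkPermutation L zero v
    separatedFrom-0 zero 0≢0 = contradiction refl 0≢0
    separatedFrom-0 (suc zero) _ φ = ¬isolatedIn (λ ()) (λ ()) (StarInLink-transport L φ isolatedIn-0)
    separatedFrom-0 v@(suc (suc _)) _ φ with v ≟ last
    ... | yes refl  = ¬nearlyDominatingIn-last (NearStarInLink-transport L φ nearlyDominatingIn-0)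
    ... | no v≢last = ¬isolatedIn (λ ()) v≢last (StarInLink-transport L φ isolatedIn-0)

    separated : ∀ u v → u ≢ v → ¬ LinkPermutation L u v
    separated zero v = separatedFrom-0 v
    separated u zero u≢0 φ = separatedFrom-0 u (≢-sym u≢0) (LinkPermutation-sym L φ)
    separated (suc zero) (suc zero) 1≢1 = contradiction refl 1≢1
    separated (suc zero) (suc (suc _)) _ φ = ¬dominatingIn (λ ()) (λ ()) (StarInLink-transport L φ dominatingIn-1)
    separated (suc (suc _)) (suc zero) _ φ =
      ¬dominatingIn (λ ()) (λ ()) (StarInLink-transport L (LinkPermutation-sym L φ) dominatingIn-1)
    separated (suc (suc u)) (suc (suc v)) u≢v φ =
      u≢v (cong (λ (w : Fin (4 + m)) → suc (suc w)) (degree-separates {u} {v} φ))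

  L-usesExactly : UsesExactly L 2
  L-usesExactly = shiftedLabeling-usesExactly heaviness heaviness-sym
    ((λ x y _ → indicator<2 (heavy? (toℕ x) (toℕ y))) , attained)
    where
    indicator<2 : {A : Set} (d : Dec A) → indicator d < 2
    indicator<2 d with does d
    ... | true  = s≤s (s≤s z≤n)
    ... | false = s≤s z≤n
    attained : ∀ (a : Fin 2) → ∃₂ λ x y → x ≢ y × heaviness x y ≡ toℕ a
    attained zero       = zero , suc (suc zero) , (λ ()) , ℕ.suc-injective (¬HeavyEdge⇒lab≡1 ¬HeavyEdge-0-2)
    attained (suc zero) = zero , suc zero , (λ ()) , ℕ.suc-injective (HeavyEdge⇒lab≡2 HeavyEdge-0-1)

η-K1 : η-is (K 1) (just 0)
η-K1 = (shiftedLabeling zeros (λ _ _ → refl) , irregular , shiftedLabeling-usesExactly zeros (λ _ _ → refl) range) ,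
       λ _ _ _ _ → z≤n
  where
  zeros : Fin 1 → Fin 1 → ℕ
  zeros _ _ = 0
  irregular : LinkIrregular (shiftedLabeling zeros (λ _ _ → refl))
  irregular zero zero 0≢0 = contradiction refl 0≢0
  range : HasRange zeros 0
  range = (λ { zero zero 0≢0 → contradiction refl 0≢0 }) , λ ()

η-K3-5 : ∀ n → 3 ≤ n → n ≤ 5 → η-is (K n) (just 3)
η-K3-5 1 (s≤s ()) _
η-K3-5 2 (s≤s (s≤s ())) _
η-K3-5 3 3≤n n≤5 = η≡3-byTable K3-table 3≤n n≤5 tt tt
η-K3-5 4 3≤n n≤5 = η≡3-byTable K4-table 3≤n n≤5 tt tt
η-K3-5 5 3≤n n≤5 = η≡3-byTable K5-table 3≤n n≤5 tt tt
η-K3-5 (suc (suc (suc (suc (suc (suc _)))))) _ (s≤s (s≤s (s≤s (s≤s (s≤s ())))))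

η-K≥6 : ∀ n → 6 ≤ n → η-is (K n) (just 2)
η-K≥6 _ (s≤s (s≤s (s≤s (s≤s (s≤s (s≤s (z≤n {m}))))))) =
  (L , L-linkIrregular , L-usesExactly) , λ L _ → LinkIrregular-usesAtLeast2 L
  where open HeavyGraph m

mainTheorem7 : η-is (K 1) (just 0)
    × η-is (K 2) nothing
    × (∀ (n : ℕ) → 3 ≤ n → n ≤ 5 → η-is (K n) (just 3))
    × (∀ (n : ℕ) → 6 ≤ n → η-is (K n) (just 2))
mainTheorem7 = η-K1 , K2-¬LinkIrregular , η-K3-5 , η-K≥6
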